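{- Let $n$ be a positive integer and run the following algorithm (Algorithm A) on input $n$: <br/> $k\leftarrow 1$; $x\leftarrow 1$; $y\leftarrow n-1$;<br/> while $k>0$ do:<br/> while $2x\le y$ do: $a_k\leftarrow x$; $y\leftarrow y-x$; $k\leftarrow k+1$; end while;<br/> $t\leftarrow k+1$;<br/> while $x\le y$ do: $a_k\leftarrow x$; $a_t\leftarrow y$; visit $a_1,\ldots,a_t$; $x\leftarrow x+1$; $y\leftarrow y-1$; end while;<br/> $y\leftarrow x+y-1$; $a_k\leftarrow y+1$; visit $a_1,\ldots,a_k$; $k\leftarrow k-1$; $x\leftarrow a_k+1$;<br/> end while. <br/> Then Algorithm A terminates after executing exactly $4p(n)+4p^{(2)}(n)$ assignment statements and evaluating exactly $p(n)+3p^{(2)}(n)$ boolean expressions.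
   Context: All variables are integers; $a_0,a_1,a_2,\ldots$ is an array of integer cells (with $a_0$ present, holding an arbitrary value). An "assignment statement" is one execution of a statement of the form $v\leftarrow e$; a "boolean expression evaluation" is one evaluation of the condition of a while loop (each test, including the final failing test, counts once). "visit" statements are not counted. $p(n)$ is the number of partitions of $n$ (unordered representations as sums of positive integers). $p^{(2)}(n)$ is the number of partitions $\lambda=[\lambda_1\ge\lambda_2\ge\cdots]$ of $n$ with $\lambda_1\ge 2\lambda_2$, where the one-part partition $[n]$ is considered to satisfy this condition. -}

module Defs where

open import Data.Nat using (ℕ; zero; suc; _+_; _*_; _∸_; _≤_; _<_; _≡ᵇ_)
open import Data.Integer as ℤ using (ℤ; +_; _≤ᵇ_)
open import Data.Bool using (Bool; true; false; if_then_else_)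
open import Data.List using (List; []; _∷_)
open import Data.Nat.ListAction using (sum)
open import Data.List.Relation.Unary.All using (All)
open import Data.List.Relation.Unary.Linked using (Linked)
open import Data.Maybe using (Maybe; just; nothing)
open import Data.Product using (_×_; _,_)
open import Data.Unit using (⊤)
open import Relation.Binary.PropositionalEquality using (_≡_)

record IsPartition (n : ℕ) (ps : List ℕ) : Set where
  field
    nonincreasing : Linked (λ i j → j ≤ i) ps
    positive      : All (λ i → 0 < i) ps
    sums          : sum ps ≡ n

Cond2 : List ℕ → Set
Cond2 []            = ⊤
Cond2 (_ ∷ [])      = ⊤
Cond2 (l₁ ∷ l₂ ∷ _) = 2 * l₂ ≤ l₁

-- Variables x, y and the array cells are integers; the indices k, t are
-- natural numbers (they are only ever used as array indices, and k is
-- only decremented when k > 0, so no truncation ever happens).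

-- Program points: before initialisation, at the test of the outer loop,
-- at the test of the first inner loop, at the test of the second inner
-- loop, and halted.
data Label : Set where
  start outer loop1 loop2 halt : Label

record Config : Set where
  constructor config
  field
    k   : ℕ
    t   : ℕ
    x   : ℤ
    y   : ℤ
    a   : ℕ → ℤ
    asg : ℕ      -- number of assignment statements executed so far
    bev : ℕ      -- number of boolean-expression evaluations so far
open Config public

upd : (ℕ → ℤ) → ℕ → ℤ → (ℕ → ℤ)
upd a i v j = if j ≡ᵇ i then v else a j

step : ℕ → Label → Config → Label × Config
-- k ← 1; x ← 1; y ← n − 1   (3 assignments)
step n start (config k t x y a as bv) =
  outer , config 1 t (+ 1) (+ n ℤ.- + 1) a (as + 3) bv
step n outer (config zero t x y a as bv) =
  halt , config zero t x y a as (suc bv)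
step n outer (config (suc k) t x y a as bv) =
  loop1 , config (suc k) t x y a as (suc bv)
step n loop1 (config k t x y a as bv) =
  if (+ 2 ℤ.* x) ≤ᵇ y
  -- a_k ← x; y ← y − x; k ← k + 1   (3 assignments)
  then (loop1 , config (suc k) t x (y ℤ.- x) (upd a k x) (as + 3) (suc bv))
  else (loop2 , config k (suc k) x y a (as + 1) (suc bv))
step n loop2 (config k t x y a as bv) =
  if x ≤ᵇ y
  -- a_k ← x; a_t ← y; visit; x ← x + 1; y ← y − 1   (4 assignments)
  then (loop2 , config k t (x ℤ.+ + 1) (y ℤ.- + 1) (upd (upd a k x) t y)
                       (as + 4) (suc bv))
  -- y ← x + y − 1; a_k ← y + 1; visit; k ← k − 1; x ← a_k + 1
  -- (4 assignments)
  else (let y' = x ℤ.+ y ℤ.- + 1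
            a' = upd a k (y' ℤ.+ + 1)
            k' = k ∸ 1
        in outer , config k' t (a' k' ℤ.+ + 1) y' a' (as + 4) (suc bv))
step n halt c = halt , c

run : ℕ → ℕ → Label → Config → Maybe (ℕ × ℕ)
run n _ halt c = just (asg c , bev c)
run n zero l c = nothing
run n (suc f) l c with step n l c
... | l' , c' = run n f l' c'

-- Initial configuration: arbitrary initial array contents (in particular
-- a₀ is arbitrary); scalar variables are assigned before being read.
initConfig : (ℕ → ℤ) → Config
initConfig a = config 0 0 (+ 0) (+ 0) a 0 0

module Submission where

-- For x ≥ 1 let Parts(x, s) be the set of partitions of s into at least two parts, all of them
-- at least x.  Splitting off the smallest part gives, for x ≤ y,
--   Parts(x, x + y) = { λ ++ [x] | λ ∈ Parts(x, y) } ⊎ { [y, x] } ⊎ Parts(x + 1, x + y),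
-- and Parts(x, x + y) = ∅ when y < x.  Appending a smallest part to a partition with at least two
-- parts does not change whether λ₁ ≥ 2λ₂, and [y, x] satisfies it iff 2x ≤ y.

open import Defs
open import Data.Nat as ℕ using (ℕ; zero; suc; _+_; _*_; _∸_; _≤_; _<_; z≤n; s≤s; _≤ᵇ_; _≤?_)
open import Data.Nat.Properties
open import Data.Nat.ListAction using (sum)
open import Data.Nat.ListAction.Properties using (sum-++)
open import Data.Nat.Tactic.RingSolver using (solve-∀)
open import Data.Integer as ℤ using (ℤ; +_)
import Data.Integer.Properties as ℤP
open import Data.Bool using (true; false; if_then_else_)
open import Data.List using (List; []; _∷_; _∷ʳ_; _++_; map; length; filter; initLast; _∷ʳ′_)
open import Data.List.Properties using (length-++; length-map; filter-++; ∷ʳ-injective)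
open import Data.List.Relation.Unary.All as All using (All; []; _∷_)
import Data.List.Relation.Unary.All.Properties as All
open import Data.List.Relation.Unary.Any using (here; there)
open import Data.List.Relation.Unary.Linked using (Linked; []; [-]; _∷_)
open import Data.List.Relation.Unary.Unique.Propositional using (Unique)
import Data.List.Relation.Unary.Unique.Propositional.Properties as Unique
open import Data.List.Relation.Unary.AllPairs using ([]; _∷_)
open import Data.List.Membership.Propositional using (_∈_)
open import Data.List.Membership.Propositional.Properties using (∈-map⁺; ∈-map⁻; ∈-++⁺ˡ; ∈-++⁺ʳ; ∈-++⁻; ∈-filter⁺; ∈-filter⁻)
open import Data.List.Membership.Propositional.Properties.WithK using (unique∧set⇒bag)
open import Data.List.Relation.Binary.BagAndSetEquality using (∼bag⇒↭)
open import Data.List.Relation.Binary.Permutation.Propositional.Properties using (↭-length)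
open import Data.Product using (_×_; _,_; ∃-syntax; proj₁; proj₂)
open import Data.Sum using (_⊎_; inj₁; inj₂)
open import Data.Unit using (tt)
open import Data.Maybe using (just)
open import Function.Bundles using (_⇔_; mk⇔; Equivalence)
import Function.Properties.Equivalence as ⇔
open import Relation.Nullary using (yes; no; ¬_; contradiction)
open import Relation.Nullary.Decidable using (dec-true; dec-false)
open import Level using (0ℓ)
open import Relation.Unary using (Pred; Decidable)
open import Relation.Binary.PropositionalEquality

≤ᵇ-true : ∀ {m n} → m ≤ n → (m ≤ᵇ n) ≡ true
≤ᵇ-true m≤n = dec-true (_ ≤? _) m≤n

≤ᵇ-false : ∀ {m n} → n < m → (m ≤ᵇ n) ≡ false
≤ᵇ-false n<m = dec-false (_ ≤? _) (<⇒≱ n<m)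

+-sub : ∀ m n → n ≤ m → + m ℤ.- + n ≡ + (m ∸ n)
+-sub m n n≤m = trans (ℤP.m-n≡m⊖n m n) (ℤP.⊖-≥ n≤m)

+-suc′ : ∀ m → + m ℤ.+ + 1 ≡ + suc m
+-suc′ m = cong +_ (+-comm m 1)

-- In the second inner loop y ≥ 1, so y − 1 is computed without truncation.
visit-pos : ∀ {x y} → x ≤ y → y < 2 * x → 1 ≤ y
visit-pos {suc x} x≤y _ = ≤-trans (s≤s z≤n) x≤y

pred-< : ∀ {y f} → 1 ≤ y → y < suc f → y ∸ 1 < f
pred-< {suc y} _ (s≤s y<f) = y<f

sub-< : ∀ {x y f} → 1 ≤ x → 1 ≤ y → y < suc f → y ∸ x < f
sub-< {x} {y} 1≤x 1≤y y<f = ≤-<-trans (∸-monoʳ-≤ y 1≤x) (pred-< 1≤y y<f)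

shift : ∀ x {y} → 1 ≤ y → suc x + (y ∸ 1) ≡ x + y
shift x {suc y} _ = sym (+-suc x y)

below-double-step : ∀ {x y} → y < 2 * x → y ∸ 1 < 2 * suc x
below-double-step {x} {y} y<2x = ≤-<-trans (m∸n≤m y 1) (<-≤-trans y<2x (*-monoʳ-≤ 2 (n≤1+n x)))

double⇒≤ : ∀ {x y} → 2 * x ≤ y → x ≤ y
double⇒≤ {x} 2x≤y = ≤-trans (m≤m+n x (x + 0)) 2x≤y

descend-< : ∀ {x y f} → 1 ≤ x → 2 * x ≤ y → y < suc f → y ∸ x < f × y ∸ 1 < f
descend-< {x} {y} 1≤x 2x≤y y<f = sub-< 1≤x 1≤y y<f , pred-< 1≤y y<f
  where 1≤y : 1 ≤ y
        1≤y = ≤-trans 1≤x (double⇒≤ 2x≤y)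

-- The recurrences.  B f x y counts the partitions of x + y into at least two parts, all ≥ x,
-- and C f x y those among them with λ₁ ≥ 2λ₂ (both correct when y < f, see parts below).

B : ℕ → ℕ → ℕ → ℕ
B zero    x y = 0
B (suc f) x y = if x ≤ᵇ y then B f x (y ∸ x) + suc (B f (suc x) (y ∸ 1)) else 0

C : ℕ → ℕ → ℕ → ℕ
C zero    x y = 0
C (suc f) x y = if x ≤ᵇ y
  then C f x (y ∸ x) + (if 2 * x ≤ᵇ y then suc (C f (suc x) (y ∸ 1)) else C f (suc x) (y ∸ 1))
  else 0

B-split : ∀ {f x y} → x ≤ y → B (suc f) x y ≡ B f x (y ∸ x) + suc (B f (suc x) (y ∸ 1))
B-split x≤y rewrite ≤ᵇ-true x≤y = refl

B-empty : ∀ f {x y} → y < x → B f x y ≡ 0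
B-empty zero    y<x = refl
B-empty (suc f) y<x rewrite ≤ᵇ-false y<x = refl

C-split : ∀ {f x y} → 2 * x ≤ y → C (suc f) x y ≡ C f x (y ∸ x) + suc (C f (suc x) (y ∸ 1))
C-split {x = x} {y} 2x≤y rewrite ≤ᵇ-true {x} {y} (double⇒≤ 2x≤y) | ≤ᵇ-true 2x≤y = refl

sub-below : ∀ {x y} → x ≤ y → y < 2 * x → y ∸ x < x
sub-below {x} {y} x≤y y<2x = +-cancelˡ-< x (y ∸ x) x (begin-strict
  x + (y ∸ x) ≡⟨ m+[n∸m]≡n x≤y ⟩
  y           <⟨ y<2x ⟩
  2 * x       ≡⟨ cong (_+_ x) (+-identityʳ x) ⟩
  x + x       ∎)
  where open ≤-Reasoning

-- When y < 2x nothing is counted by C: λ₁ ≥ 2λ₂ ≥ 2x would give λ₁ + λ₂ ≥ 3x > x + y.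
C-empty : ∀ f {x y} → y < 2 * x → C f x y ≡ 0
C-empty zero    y<2x = refl
C-empty (suc f) {x} {y} y<2x with x ≤? y
... | no  y≱x rewrite ≤ᵇ-false (≰⇒> y≱x) = refl
... | yes x≤y rewrite ≤ᵇ-true x≤y | ≤ᵇ-false y<2x
                    | C-empty f {x} {y ∸ x} (≤-trans (sub-below x≤y y<2x) (m≤m+n x (x + 0)))
                    | C-empty f {suc x} {y ∸ 1} (below-double-step y<2x)
                    = refl

module Trace (n : ℕ) where

  State : Set
  State = Label × Config

  infixr 5 _▸_
  data Trace : State → State → Set where
    []  : ∀ {s} → Trace s s
    _▸_ : ∀ {l c s′ s″} → step n l c ≡ s′ → Trace s′ s″ → Trace (l , c) s″

  _++ᵗ_ : ∀ {s s′ s″} → Trace s s′ → Trace s′ s″ → Trace s s″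
  []      ++ᵗ τ′ = τ′
  (e ▸ τ) ++ᵗ τ′ = e ▸ (τ ++ᵗ τ′)

  run-step : ∀ f l c → run n (suc f) l c ≡ run n f (proj₁ (step n l c)) (proj₂ (step n l c))
  run-step f start c = refl
  run-step f outer c = refl
  run-step f loop1 c = refl
  run-step f loop2 c = refl
  run-step f halt  c = refl

  trace-run : ∀ {l c c′} → Trace (l , c) (halt , c′) → ∃[ fuel ] run n fuel l c ≡ just (asg c′ , bev c′)
  trace-run []                       = 0 , refl
  trace-run {l} {c} (refl ▸ τ) with trace-run τ
  ... | fuel , eq = suc fuel , trans (run-step fuel l c) eq

AgreeUpTo : ℕ → (ℕ → ℤ) → (ℕ → ℤ) → Set
AgreeUpTo j a a′ = ∀ i → i ≤ j → a′ i ≡ a i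

agree-trans : ∀ {j a b c} → AgreeUpTo j a b → AgreeUpTo j b c → AgreeUpTo j a c
agree-trans a~b b~c i i≤j = trans (b~c i i≤j) (a~b i i≤j)

agree-weaken : ∀ {j a a′} → AgreeUpTo (suc j) a a′ → AgreeUpTo j a a′
agree-weaken agree i i≤j = agree i (m≤n⇒m≤1+n i≤j)

upd-agree : ∀ {j i} v a → j < i → AgreeUpTo j a (upd a i v)
upd-agree {j} {i} v a j<i i′ i′≤j
  rewrite dec-false (i′ ℕ.≟ i) (<⇒≢ (≤-<-trans i′≤j j<i)) = refl

upd-same : ∀ i v a → upd a i v i ≡ v
upd-same i v a rewrite dec-true (i ℕ.≟ i) refl = refl

cfg : ℕ → ℕ → ℕ → ℕ → (ℕ → ℤ) → ℕ → ℕ → Config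
cfg k t x y a as bv = config k t (+ x) (+ y) a as bv

returned : ℕ → ℕ → (ℕ → ℤ) → ℕ → ℕ → ℕ → Config
returned j t a s as bv = config j t (a j ℤ.+ + 1) (+ (s ∸ 1)) a as bv

returned-≡ : ∀ {j t a s s′ as as′ bv bv′} → s ≡ s′ → as ≡ as′ → bv ≡ bv′
           → returned j t a s as bv ≡ returned j t a s′ as′ bv′
returned-≡ refl refl refl = refl

-- On leaving the second inner loop x + y ≥ 1, so x + y − 1 is computed without truncation.
1≤x+y : ∀ {x y} → y < x → 1 ≤ x + y
1≤x+y {x} {y} y<x = ≤-trans (≤-<-trans z≤n y<x) (m≤m+n x y)

module Steps (n : ℕ) {k t x y : ℕ} {a : ℕ → ℤ} {as bv : ℕ} where

  step-descend : 2 * x ≤ y → step n loop1 (cfg k t x y a as bv)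
               ≡ (loop1 , cfg (suc k) t x (y ∸ x) (upd a k (+ x)) (as + 3) (suc bv))
  step-descend 2x≤y rewrite ℤP.+◃n≡+n (2 * x) | ≤ᵇ-true 2x≤y
                          | +-sub y x (double⇒≤ 2x≤y) = refl

  step-exit : y < 2 * x → step n loop1 (cfg k t x y a as bv)
            ≡ (loop2 , cfg k (suc k) x y a (as + 1) (suc bv))
  step-exit y<2x rewrite ℤP.+◃n≡+n (2 * x) | ≤ᵇ-false y<2x = refl

  step-visit : 1 ≤ y → x ≤ y → step n loop2 (cfg k t x y a as bv)
             ≡ (loop2 , cfg k t (suc x) (y ∸ 1) (upd (upd a k (+ x)) t (+ y)) (as + 4) (suc bv))
  step-visit 1≤y x≤y rewrite ≤ᵇ-true x≤y | +-suc′ x | +-sub y 1 1≤y = refl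

  step-return : y < x → step n loop2 (cfg k t x y a as bv)
              ≡ (outer , returned (k ∸ 1) t (upd a k (+ (x + y))) (x + y) (as + 4) (suc bv))
  step-return y<x rewrite ≤ᵇ-false y<x | +-sub (x + y) 1 (1≤x+y y<x)
                        | m∸n+n≡m (1≤x+y y<x) = refl

-- In the second inner loop each iteration visits exactly one partition.
B-visit : ∀ {f x y} → x ≤ y → y < 2 * x → B (suc f) x y ≡ suc (B f (suc x) (y ∸ 1))
B-visit {f} {x} {y} x≤y y<2x =
  trans (B-split {f} x≤y) (cong (_+ suc (B f (suc x) (y ∸ 1))) (B-empty f (sub-below x≤y y<2x)))

-- one iteration of the second inner loop followed by the rest of it
visit-asg : ∀ {f x y} as → x ≤ y → y < 2 * x
          → as + 4 + (4 * B f (suc x) (y ∸ 1) + 4) ≡ as + (4 * B (suc f) x y + 4)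
visit-asg {f} {x} {y} as x≤y y<2x =
  trans (ring as (B f (suc x) (y ∸ 1))) (cong (λ b → as + (4 * b + 4)) (sym (B-visit {f} x≤y y<2x)))
  where ring : ∀ as b → as + 4 + (4 * b + 4) ≡ as + (4 * suc b + 4)
        ring = solve-∀

visit-bev : ∀ {f x y} bv → x ≤ y → y < 2 * x
          → suc bv + (B f (suc x) (y ∸ 1) + 1) ≡ bv + (B (suc f) x y + 1)
visit-bev {f} {x} {y} bv x≤y y<2x =
  trans (ring bv (B f (suc x) (y ∸ 1))) (cong (λ b → bv + (b + 1)) (sym (B-visit {f} x≤y y<2x)))
  where ring : ∀ bv b → suc bv + (b + 1) ≡ bv + (suc b + 1)
        ring = solve-∀

-- leaving the first inner loop (y < 2x) and running the second one
exit-asg : ∀ {f x y} as → y < 2 * x → as + 1 + (4 * B f x y + 4) ≡ as + (4 * B f x y + 4 * C f x y + 5)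
exit-asg {f} {x} {y} as y<2x =
  trans (ring as (B f x y)) (cong (λ c → as + (4 * B f x y + 4 * c + 5)) (sym (C-empty f y<2x)))
  where ring : ∀ as b → as + 1 + (4 * b + 4) ≡ as + (4 * b + 4 * 0 + 5)
        ring = solve-∀

exit-bev : ∀ {f x y} bv → y < 2 * x → suc bv + (B f x y + 1) ≡ bv + (B f x y + 3 * C f x y + 2)
exit-bev {f} {x} {y} bv y<2x =
  trans (ring bv (B f x y)) (cong (λ c → bv + (B f x y + 3 * c + 2)) (sym (C-empty f y<2x)))
  where ring : ∀ bv b → suc bv + (b + 1) ≡ bv + (b + 3 * 0 + 2)
        ring = solve-∀

-- one iteration of the first inner loop, the recursive call for (x, y − x), the outer test,
-- and the first inner loop for (x + 1, y − 1)
descend-asg : ∀ {f x y} as → 2 * x ≤ y →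
  as + 3 + (4 * B f x (y ∸ x) + 4 * C f x (y ∸ x) + 5) + (4 * B f (suc x) (y ∸ 1) + 4 * C f (suc x) (y ∸ 1) + 5)
  ≡ as + (4 * B (suc f) x y + 4 * C (suc f) x y + 5)
descend-asg {f} {x} {y} as 2x≤y =
  trans (ring as (B f x (y ∸ x)) (C f x (y ∸ x)) (B f (suc x) (y ∸ 1)) (C f (suc x) (y ∸ 1)))
        (cong₂ (λ b c → as + (4 * b + 4 * c + 5)) (sym (B-split {f} (double⇒≤ 2x≤y))) (sym (C-split {f} 2x≤y)))
  where ring : ∀ as b₁ c₁ b₂ c₂ → as + 3 + (4 * b₁ + 4 * c₁ + 5) + (4 * b₂ + 4 * c₂ + 5)
                                 ≡ as + (4 * (b₁ + suc b₂) + 4 * (c₁ + suc c₂) + 5)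
        ring = solve-∀

descend-bev : ∀ {f x y} bv → 2 * x ≤ y →
  suc (suc bv + (B f x (y ∸ x) + 3 * C f x (y ∸ x) + 2)) + (B f (suc x) (y ∸ 1) + 3 * C f (suc x) (y ∸ 1) + 2)
  ≡ bv + (B (suc f) x y + 3 * C (suc f) x y + 2)
descend-bev {f} {x} {y} bv 2x≤y =
  trans (ring bv (B f x (y ∸ x)) (C f x (y ∸ x)) (B f (suc x) (y ∸ 1)) (C f (suc x) (y ∸ 1)))
        (cong₂ (λ b c → bv + (b + 3 * c + 2)) (sym (B-split {f} (double⇒≤ 2x≤y))) (sym (C-split {f} 2x≤y)))
  where ring : ∀ bv b₁ c₁ b₂ c₂ → suc (suc bv + (b₁ + 3 * c₁ + 2)) + (b₂ + 3 * c₂ + 2)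
                                 ≡ bv + ((b₁ + suc b₂) + 3 * (c₁ + suc c₂) + 2)
        ring = solve-∀

-- Back in the outer loop after the recursive call for (x, y − x), which left a_{j+1} = x:
-- the first inner loop is resumed with x + 1 and y − 1.
resume-≡ : ∀ {j t x y a as bv} → x ≤ y → a (suc j) ≡ + x
         → returned (suc j) t a (x + (y ∸ x)) as bv ≡ cfg (suc j) t (suc x) (y ∸ 1) a as bv
resume-≡ {j} {t} {x} {y} {a} {as} {bv} x≤y a[j+1]≡x =
  cong₂ (λ x′ y′ → config (suc j) t x′ y′ a as bv)
        (trans (cong (ℤ._+ + 1) a[j+1]≡x) (+-suc′ x)) (cong (λ s → + (s ∸ 1)) (m+[n∸m]≡n x≤y))

module Simulation (n : ℕ) where
  open Trace n
  open Steps n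

  retarget : ∀ {s l c c′} → c ≡ c′ → Trace s (l , c) → Trace s (l , c′)
  retarget refl τ = τ

  -- The second inner loop, entered with k = j + 1 and y < 2x: it visits the B f x y partitions
  -- […, y, x], […, y − 1, x + 1], … and returns to the outer test, leaving a₀ … a_j intact.
  loop2-trace : ∀ f j t x y a as bv → y < f → y < 2 * x → j < t →
    ∃[ a′ ] AgreeUpTo j a a′ ×
      Trace (loop2 , cfg (suc j) t x y a as bv)
            (outer , returned j t a′ (x + y) (as + (4 * B f x y + 4)) (bv + (B f x y + 1)))
  loop2-trace (suc f) j t x y a as bv y<f y<2x j<t with x ≤? y
  ... | no y≱x = upd a (suc j) (+ (x + y)) , upd-agree _ a ≤-refl ,
        retarget (returned-≡ {s = x + y} refl (cong (λ b → as + (4 * b + 4)) (sym (B-empty (suc f) (≰⇒> y≱x))))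
                                  (trans (+-comm 1 bv) (cong (λ b → bv + (b + 1)) (sym (B-empty (suc f) (≰⇒> y≱x))))))
                 (step-return (≰⇒> y≱x) ▸ [])
  ... | yes x≤y with loop2-trace f j t (suc x) (y ∸ 1) (upd (upd a (suc j) (+ x)) t (+ y)) (as + 4) (suc bv)
                                 (pred-< (visit-pos x≤y y<2x) y<f) (below-double-step y<2x) j<t
  ... | a′ , agree , τ =
        a′ , agree-trans (agree-trans (upd-agree _ a ≤-refl) (upd-agree _ _ j<t)) agree ,
        step-visit 1≤y x≤y ▸ retarget
          (returned-≡ (shift x 1≤y) (visit-asg {f} as x≤y y<2x) (visit-bev {f} bv x≤y y<2x))
          τ
    where 1≤y : 1 ≤ y
          1≤y = visit-pos x≤y y<2x

  -- The first inner loop, entered with k = j + 1: it visits the B f x y partitions (after the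
  -- prefix a₁ … a_j) and returns to the outer test with k = j, x = a_j + 1, leaving a₀ … a_j
  -- intact.  If 2x ≤ y it recurses on (x, y − x) with k = j + 2 and then continues at (x + 1, y − 1).
  loop1-trace : ∀ f j t x y a as bv → y < f → 1 ≤ x →
    ∃[ a′ ] ∃[ t′ ] AgreeUpTo j a a′ ×
      Trace (loop1 , cfg (suc j) t x y a as bv)
            (outer , returned j t′ a′ (x + y) (as + (4 * B f x y + 4 * C f x y + 5))
                                              (bv + (B f x y + 3 * C f x y + 2)))
  loop1-trace f j t x y a as bv y<f 1≤x with 2 * x ≤? y
  ... | no y≱2x with loop2-trace f j (suc (suc j)) x y a (as + 1) (suc bv) y<f (≰⇒> y≱2x) (n≤1+n (suc j))
  ... | a′ , agree , τ = a′ , suc (suc j) , agree , step-exit (≰⇒> y≱2x) ▸ retarget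
          (returned-≡ {s = x + y} refl (exit-asg {f} as (≰⇒> y≱2x)) (exit-bev {f} bv (≰⇒> y≱2x)))
          τ
  loop1-trace (suc f) j t x y a as bv y<f 1≤x | yes 2x≤y
    with loop1-trace f (suc j) t x (y ∸ x) (upd a (suc j) (+ x)) (as + 3) (suc bv)
                     (proj₁ (descend-< 1≤x 2x≤y y<f)) 1≤x
  ... | a₁ , t₁ , agree₁ , τ₁
    with loop1-trace f j t₁ (suc x) (y ∸ 1) a₁
                     (as + 3 + (4 * B f x (y ∸ x) + 4 * C f x (y ∸ x) + 5))
                     (suc (suc bv + (B f x (y ∸ x) + 3 * C f x (y ∸ x) + 2)))
                     (proj₂ (descend-< 1≤x 2x≤y y<f)) (s≤s z≤n)
  ... | a₂ , t₂ , agree₂ , τ₂ =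
        a₂ , t₂ , agree-trans (upd-agree _ a ≤-refl) (agree-trans (agree-weaken agree₁) agree₂) ,
        step-descend 2x≤y ▸
          (retarget (resume-≡ x≤y (trans (agree₁ (suc j) ≤-refl) (upd-same (suc j) (+ x) a))) τ₁ ++ᵗ
           (refl ▸ retarget (returned-≡ (shift x (≤-trans 1≤x x≤y)) (descend-asg {f} as 2x≤y) (descend-bev {f} bv 2x≤y)) τ₂))
    where
      x≤y : x ≤ y
      x≤y = double⇒≤ 2x≤y

  -- The whole run: initialisation, the outer test, the first inner loop for (1, n − 1) with
  -- k = 1, and the final outer test with k = 0.
  algorithm-run : 1 ≤ n → ∀ a → ∃[ fuel ] run n fuel start (initConfig a)
    ≡ just (3 + (4 * B n 1 (n ∸ 1) + 4 * C n 1 (n ∸ 1) + 5) , suc (1 + (B n 1 (n ∸ 1) + 3 * C n 1 (n ∸ 1) + 2)))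
  algorithm-run 1≤n a with loop1-trace n 0 0 1 (n ∸ 1) a 3 1 (pred-< 1≤n (n<1+n n)) ≤-refl
  ... | _ , _ , _ , τ = trace-run {start} {initConfig a} (initialise ▸ refl ▸ (τ ++ᵗ (refl ▸ [])))
    where
      initialise : step n start (initConfig a) ≡ (outer , cfg 1 0 1 (n ∸ 1) a 3 0)
      initialise = cong (λ y → outer , config 1 0 (+ 1) y a 3 0) (+-sub n 1 1≤n)

Nonincreasing : List ℕ → Set
Nonincreasing = Linked (λ i j → j ≤ i)

record IsPartAbove (x s : ℕ) (l : List ℕ) : Set where
  field
    nonincreasing : Nonincreasing l
    bounded       : All (x ≤_) l
    sums          : sum l ≡ s
    twoParts      : 2 ≤ length l

-- The partitions of x + y into at least two parts, all ≥ x (when y < f), grouped by their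
-- smallest part: smallest part x with three or more parts, the pair [y, x], smallest part > x.
parts : ℕ → ℕ → ℕ → List (List ℕ)
parts zero    x y = []
parts (suc f) x y = if x ≤ᵇ y
  then map (_∷ʳ x) (parts f x (y ∸ x)) ++ (y ∷ x ∷ []) ∷ parts f (suc x) (y ∸ 1)
  else []

parts-split : ∀ {f x y} → x ≤ y
            → parts (suc f) x y ≡ map (_∷ʳ x) (parts f x (y ∸ x)) ++ (y ∷ x ∷ []) ∷ parts f (suc x) (y ∸ 1)
parts-split x≤y rewrite ≤ᵇ-true x≤y = refl

parts-empty : ∀ {f x y} → y < x → parts (suc f) x y ≡ []
parts-empty y<x rewrite ≤ᵇ-false y<x = refl

∷ʳ-nonincreasing⁺ : ∀ l v → Nonincreasing l → All (v ≤_) l → Nonincreasing (l ∷ʳ v)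
∷ʳ-nonincreasing⁺ []          v _         _            = [-]
∷ʳ-nonincreasing⁺ (a ∷ [])    v _         (v≤a ∷ [])   = v≤a ∷ [-]
∷ʳ-nonincreasing⁺ (a ∷ b ∷ r) v (b≤a ∷ d) (_ ∷ v≤b∷r) = b≤a ∷ ∷ʳ-nonincreasing⁺ (b ∷ r) v d v≤b∷r

∷ʳ-nonincreasing⁻ : ∀ l v → Nonincreasing (l ∷ʳ v) → Nonincreasing l × All (v ≤_) l
∷ʳ-nonincreasing⁻ []          v _         = [] , []
∷ʳ-nonincreasing⁻ (a ∷ [])    v (v≤a ∷ _) = [-] , (v≤a ∷ [])
∷ʳ-nonincreasing⁻ (a ∷ b ∷ r) v (b≤a ∷ d) with ∷ʳ-nonincreasing⁻ (b ∷ r) v d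
... | d′ , (v≤b ∷ v≤r) = b≤a ∷ d′ , (≤-trans v≤b b≤a ∷ v≤b ∷ v≤r)

sum-∷ʳ : ∀ l v → sum (l ∷ʳ v) ≡ sum l + v
sum-∷ʳ l v = trans (sum-++ l (v ∷ [])) (cong (_+_ (sum l)) (+-identityʳ v))

length-∷ʳ : ∀ (l : List ℕ) v → length (l ∷ʳ v) ≡ suc (length l)
length-∷ʳ l v = trans (length-++ l) (+-comm (length l) 1)

partAbove-bound : ∀ {x y l} → IsPartAbove x (x + y) l → x ≤ y
partAbove-bound {l = []}     record { twoParts = () }
partAbove-bound {l = _ ∷ []} record { twoParts = s≤s () }
partAbove-bound {x} {y} {a ∷ b ∷ r} pa = +-cancelˡ-≤ x x y (begin
  x + x             ≤⟨ +-mono-≤ x≤a (≤-trans x≤b (m≤m+n b (sum r))) ⟩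
  a + (b + sum r)   ≡⟨ IsPartAbove.sums pa ⟩
  x + y             ∎)
  where
    open ≤-Reasoning
    x≤a : x ≤ a
    x≤a = All.head (IsPartAbove.bounded pa)
    x≤b : x ≤ b
    x≤b = All.head (All.tail (IsPartAbove.bounded pa))

smallest-part-sum : ∀ {x y} l → x ≤ y → sum (l ∷ʳ x) ≡ x + y → sum l ≡ x + (y ∸ x)
smallest-part-sum {x} {y} l x≤y s = begin
  sum l       ≡⟨ +-cancelʳ-≡ x (sum l) y (trans (sym (sum-∷ʳ l x)) (trans s (+-comm x y))) ⟩
  y           ≡⟨ sym (m+[n∸m]≡n x≤y) ⟩
  x + (y ∸ x) ∎
  where open ≡-Reasoning

append-smallest : ∀ {x y l} → x ≤ y → IsPartAbove x (x + (y ∸ x)) l → IsPartAbove x (x + y) (l ∷ʳ x)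
append-smallest {x} {y} {l} x≤y pa = record
  { nonincreasing = ∷ʳ-nonincreasing⁺ l x (IsPartAbove.nonincreasing pa) (IsPartAbove.bounded pa)
  ; bounded       = All.∷ʳ⁺ (IsPartAbove.bounded pa) ≤-refl
  ; sums          = begin
      sum (l ∷ʳ x)      ≡⟨ sum-∷ʳ l x ⟩
      sum l + x         ≡⟨ cong (_+ x) (trans (IsPartAbove.sums pa) (m+[n∸m]≡n x≤y)) ⟩
      y + x             ≡⟨ +-comm y x ⟩
      x + y             ∎
  ; twoParts      = ≤-trans (IsPartAbove.twoParts pa) (≤-trans (n≤1+n _) (≤-reflexive (sym (length-∷ʳ l x))))
  }
  where open ≡-Reasoning

pair-part : ∀ {x y} → x ≤ y → IsPartAbove x (x + y) (y ∷ x ∷ [])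
pair-part {x} {y} x≤y = record
  { nonincreasing = x≤y ∷ [-]
  ; bounded       = x≤y ∷ ≤-refl ∷ []
  ; sums          = trans (cong (_+_ y) (+-identityʳ x)) (+-comm y x)
  ; twoParts      = ≤-refl
  }

lower-bound : ∀ {x y l} → 1 ≤ y → IsPartAbove (suc x) (suc x + (y ∸ 1)) l → IsPartAbove x (x + y) l
lower-bound {x} 1≤y pa = record
  { nonincreasing = IsPartAbove.nonincreasing pa
  ; bounded       = All.map (≤-trans (n≤1+n x)) (IsPartAbove.bounded pa)
  ; sums          = trans (IsPartAbove.sums pa) (shift x 1≤y)
  ; twoParts      = IsPartAbove.twoParts pa
  }

drop-smallest : ∀ {x y l} → x ≤ y → 2 ≤ length l → IsPartAbove x (x + y) (l ∷ʳ x) → IsPartAbove x (x + (y ∸ x)) l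
drop-smallest {x} {y} {l} x≤y long pa = record
  { nonincreasing = proj₁ (∷ʳ-nonincreasing⁻ l x (IsPartAbove.nonincreasing pa))
  ; bounded       = proj₁ (All.∷ʳ⁻ (IsPartAbove.bounded pa))
  ; sums          = smallest-part-sum l x≤y (IsPartAbove.sums pa)
  ; twoParts      = long
  }

pair-smallest : ∀ {x y i} → IsPartAbove x (x + y) (i ∷ x ∷ []) → i ≡ y
pair-smallest {x} {y} {i} pa = +-cancelʳ-≡ x i y (trans (cong (_+_ i) (sym (+-identityʳ x)))
                                                      (trans (IsPartAbove.sums pa) (+-comm x y)))

raise-bound : ∀ {x y l v} → x < v → 1 ≤ y → IsPartAbove x (x + y) (l ∷ʳ v)
            → IsPartAbove (suc x) (suc x + (y ∸ 1)) (l ∷ʳ v)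
raise-bound {x} {y} {l} {v} x<v 1≤y pa = record
  { nonincreasing = IsPartAbove.nonincreasing pa
  ; bounded       = All.∷ʳ⁺ (All.map (<-≤-trans x<v) (proj₂ (∷ʳ-nonincreasing⁻ l v (IsPartAbove.nonincreasing pa)))) x<v
  ; sums          = trans (IsPartAbove.sums pa) (sym (shift x 1≤y))
  ; twoParts      = IsPartAbove.twoParts pa
  }

parts-sound : ∀ f x y {l} → 1 ≤ x → l ∈ parts f x y → IsPartAbove x (x + y) l
parts-sound (suc f) x y {l} 1≤x l∈ with x ≤? y
... | no y≱x with subst (l ∈_) (parts-empty {f} (≰⇒> y≱x)) l∈
...   | ()
parts-sound (suc f) x y {l} 1≤x l∈ | yes x≤y
  with ∈-++⁻ (map (_∷ʳ x) (parts f x (y ∸ x))) (subst (l ∈_) (parts-split {f} x≤y) l∈)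
... | inj₁ l∈map with ∈-map⁻ (_∷ʳ x) l∈map
...   | l′ , l′∈ , refl = append-smallest x≤y (parts-sound f x (y ∸ x) 1≤x l′∈)
parts-sound (suc f) x y {l} 1≤x l∈ | yes x≤y | inj₂ (here refl) = pair-part x≤y
parts-sound (suc f) x y {l} 1≤x l∈ | yes x≤y | inj₂ (there l∈rest) =
  lower-bound (≤-trans 1≤x x≤y) (parts-sound f (suc x) (y ∸ 1) (s≤s z≤n) l∈rest)

smallest-x-∈ : ∀ {f x y} init → x ≤ y → IsPartAbove x (x + y) (init ∷ʳ x)
             → (∀ {l} → IsPartAbove x (x + (y ∸ x)) l → l ∈ parts f x (y ∸ x))
             → init ∷ʳ x ∈ map (_∷ʳ x) (parts f x (y ∸ x)) ++ (y ∷ x ∷ []) ∷ parts f (suc x) (y ∸ 1)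
smallest-x-∈ []          _   record { twoParts = s≤s () } _
smallest-x-∈ (i ∷ [])    _   pa _        = ∈-++⁺ʳ _ (here (cong (λ z → z ∷ _ ∷ []) (pair-smallest pa)))
smallest-x-∈ (i ∷ j ∷ r) x≤y pa complete =
  ∈-++⁺ˡ (∈-map⁺ (_∷ʳ _) (complete (drop-smallest x≤y (s≤s (s≤s z≤n)) pa)))

-- Completeness: every such partition is listed, in the block given by its smallest part v.
parts-complete : ∀ f x y {l} → y < f → 1 ≤ x → IsPartAbove x (x + y) l → l ∈ parts f x y
parts-complete (suc f) x y {l} y<f 1≤x pa with initLast l
parts-complete (suc f) x y {.[]} y<f 1≤x record { twoParts = () } | []
... | init ∷ʳ′ v = subst (init ∷ʳ v ∈_) (sym (parts-split {f} x≤y)) (by-smallest (m≤n⇒m<n∨m≡n x≤v))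
  where
    x≤y : x ≤ y
    x≤y = partAbove-bound pa
    1≤y : 1 ≤ y
    1≤y = ≤-trans 1≤x x≤y
    x≤v : x ≤ v
    x≤v = proj₂ (All.∷ʳ⁻ (IsPartAbove.bounded pa))
    by-smallest : x < v ⊎ x ≡ v
                → init ∷ʳ v ∈ map (_∷ʳ x) (parts f x (y ∸ x)) ++ (y ∷ x ∷ []) ∷ parts f (suc x) (y ∸ 1)
    by-smallest (inj₁ x<v) = ∈-++⁺ʳ _ (there (parts-complete f (suc x) (y ∸ 1) (pred-< 1≤y y<f) (s≤s z≤n)
                                                               (raise-bound x<v 1≤y pa)))
    by-smallest (inj₂ refl) = smallest-x-∈ {f} init x≤y pa (parts-complete f x (y ∸ x) (sub-< 1≤x 1≤y y<f) 1≤x)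

-- No list ending in x has all its parts ≥ x + 1; this separates the blocks of parts (f + 1) x y.
not-above-last : ∀ {x} l → ¬ All (suc x ≤_) (l ∷ʳ x)
not-above-last l above = 1+n≰n (proj₂ (All.∷ʳ⁻ above))

-- parts f x y has no repetitions: its three blocks are duplicate-free and pairwise disjoint.
parts-unique : ∀ f x y → 1 ≤ x → Unique (parts f x y)
parts-unique zero    x y 1≤x = []
parts-unique (suc f) x y 1≤x with x ≤? y
... | no y≱x = subst Unique (sym (parts-empty {f} (≰⇒> y≱x))) []
... | yes x≤y = subst Unique (sym (parts-split {f} x≤y))
      (Unique.++⁺ (Unique.map⁺ (λ {l} {l′} eq → proj₁ (∷ʳ-injective l l′ eq)) (parts-unique f x (y ∸ x) 1≤x))
                  (All.tabulate pair-not-above ∷ parts-unique f (suc x) (y ∸ 1) (s≤s z≤n))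
                  disjoint)
  where
    above : ∀ {l} → l ∈ parts f (suc x) (y ∸ 1) → All (suc x ≤_) l
    above l∈ = IsPartAbove.bounded (parts-sound f (suc x) (y ∸ 1) (s≤s z≤n) l∈)

    pair-not-above : ∀ {l} → l ∈ parts f (suc x) (y ∸ 1) → (y ∷ x ∷ []) ≢ l
    pair-not-above l∈ refl = not-above-last (y ∷ []) (above l∈)

    -- a list ending in x, with at least three parts, is neither [y, x] nor has all parts > x
    disjoint : ∀ {l} → ¬ (l ∈ map (_∷ʳ x) (parts f x (y ∸ x)) × l ∈ (y ∷ x ∷ []) ∷ parts f (suc x) (y ∸ 1))
    disjoint (l∈map , l∈rest) with ∈-map⁻ (_∷ʳ x) l∈map
    disjoint (_ , here eq)      | l′ , l′∈ , refl =
      <⇒≢ (s≤s (IsPartAbove.twoParts (parts-sound f x (y ∸ x) 1≤x l′∈)))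
          (trans (sym (cong length eq)) (length-∷ʳ l′ x))
    disjoint (_ , there l∈rest) | l′ , l′∈ , refl = not-above-last l′ (above l∈rest)

length-parts : ∀ f x y → length (parts f x y) ≡ B f x y
length-parts zero    x y = refl
length-parts (suc f) x y with x ≤? y
... | no y≱x rewrite ≤ᵇ-false (≰⇒> y≱x) = refl
... | yes x≤y rewrite ≤ᵇ-true x≤y = begin
  length (map (_∷ʳ x) (parts f x (y ∸ x)) ++ (y ∷ x ∷ []) ∷ parts f (suc x) (y ∸ 1))
    ≡⟨ length-++ (map (_∷ʳ x) (parts f x (y ∸ x))) ⟩
  length (map (_∷ʳ x) (parts f x (y ∸ x))) + suc (length (parts f (suc x) (y ∸ 1)))
    ≡⟨ cong₂ (λ b b′ → b + suc b′) (trans (length-map (_∷ʳ x) (parts f x (y ∸ x))) (length-parts f x (y ∸ x)))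
                                  (length-parts f (suc x) (y ∸ 1)) ⟩
  B f x (y ∸ x) + suc (B f (suc x) (y ∸ 1)) ∎
  where open ≡-Reasoning

Cond2? : Decidable Cond2
Cond2? []          = yes tt
Cond2? (_ ∷ [])    = yes tt
Cond2? (a ∷ b ∷ _) = 2 * b ≤? a

-- Appending a smallest part does not change λ₁ and λ₂.
Cond2-∷ʳ : ∀ {l} v → 2 ≤ length l → Cond2 (l ∷ʳ v) ⇔ Cond2 l
Cond2-∷ʳ {_ ∷ []}    v (s≤s ())
Cond2-∷ʳ {a ∷ b ∷ r} v _ = mk⇔ (λ c → c) (λ c → c)

length-filter-map : ∀ {A : Set} {P : Pred A 0ℓ} (P? : Decidable P) (g : A → A) {xs}
                  → All (λ z → P (g z) ⇔ P z) xs → length (filter P? (map g xs)) ≡ length (filter P? xs)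
length-filter-map P? g {[]}     []       = refl
length-filter-map P? g {z ∷ zs} (e ∷ es) with P? (g z) | P? z
... | yes _   | yes _  = cong suc (length-filter-map P? g es)
... | no  _   | no  _  = length-filter-map P? g es
... | yes pgz | no ¬pz = contradiction (Equivalence.to e pgz) ¬pz
... | no ¬pgz | yes pz = contradiction (Equivalence.from e pz) ¬pgz

length-filter-pair : ∀ x y L → length (filter Cond2? ((y ∷ x ∷ []) ∷ L))
                   ≡ (if 2 * x ≤ᵇ y then suc (length (filter Cond2? L)) else length (filter Cond2? L))
length-filter-pair x y L with 2 * x ≤? y
... | yes 2x≤y rewrite ≤ᵇ-true 2x≤y = refl
... | no  2x≰y rewrite ≤ᵇ-false (≰⇒> 2x≰y) = refl

count-parts : ∀ f x y → 1 ≤ x → length (filter Cond2? (parts f x y)) ≡ C f x y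
count-parts zero    x y 1≤x = refl
count-parts (suc f) x y 1≤x with x ≤? y
... | no y≱x rewrite ≤ᵇ-false (≰⇒> y≱x) = refl
... | yes x≤y rewrite ≤ᵇ-true x≤y = begin
  length (filter Cond2? (map (_∷ʳ x) L₁ ++ (y ∷ x ∷ []) ∷ L₂))
    ≡⟨ cong length (filter-++ Cond2? (map (_∷ʳ x) L₁) ((y ∷ x ∷ []) ∷ L₂)) ⟩
  length (filter Cond2? (map (_∷ʳ x) L₁) ++ filter Cond2? ((y ∷ x ∷ []) ∷ L₂))
    ≡⟨ length-++ (filter Cond2? (map (_∷ʳ x) L₁)) ⟩
  length (filter Cond2? (map (_∷ʳ x) L₁)) + length (filter Cond2? ((y ∷ x ∷ []) ∷ L₂))
    ≡⟨ cong₂ _+_ (length-filter-map Cond2? (_∷ʳ x) appending-preserves) (length-filter-pair x y L₂) ⟩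
  length (filter Cond2? L₁) + (if 2 * x ≤ᵇ y then suc (length (filter Cond2? L₂)) else length (filter Cond2? L₂))
    ≡⟨ cong₂ (λ c c′ → c + (if 2 * x ≤ᵇ y then suc c′ else c′))
             (count-parts f x (y ∸ x) 1≤x) (count-parts f (suc x) (y ∸ 1) (s≤s z≤n)) ⟩
  C f x (y ∸ x) + (if 2 * x ≤ᵇ y then suc (C f (suc x) (y ∸ 1)) else C f (suc x) (y ∸ 1)) ∎
  where
    open ≡-Reasoning
    L₁ L₂ : List (List ℕ)
    L₁ = parts f x (y ∸ x)
    L₂ = parts f (suc x) (y ∸ 1)
    appending-preserves : All (λ l → Cond2 (l ∷ʳ x) ⇔ Cond2 l) L₁
    appending-preserves = All.tabulate (λ l∈ → Cond2-∷ʳ x (IsPartAbove.twoParts (parts-sound f x (y ∸ x) 1≤x l∈)))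

unique-length : ∀ {A : Set} {xs ys : List A} → Unique xs → Unique ys → (∀ z → z ∈ xs ⇔ z ∈ ys)
              → length xs ≡ length ys
unique-length xs! ys! same = ↭-length (∼bag⇒↭ (unique∧set⇒bag xs! ys! (λ {z} → same z)))

module PartitionsOf (n : ℕ) (1≤n : 1 ≤ n) where

  n≡1+[n-1] : n ≡ 1 + (n ∸ 1)
  n≡1+[n-1] = sym (m+[n∸m]≡n 1≤n)

  partitions : List (List ℕ)
  partitions = parts n 1 (n ∸ 1) ++ (n ∷ []) ∷ []

  partition-∈ : ∀ ps → IsPartition n ps → ps ∈ partitions
  partition-∈ []          p = contradiction (subst (1 ≤_) (sym (IsPartition.sums p)) 1≤n) λ ()
  partition-∈ (a ∷ [])    p = ∈-++⁺ʳ (parts n 1 (n ∸ 1)) (here (cong (_∷ []) (trans (sym (+-identityʳ a)) (IsPartition.sums p))))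
  partition-∈ (a ∷ b ∷ r) p = ∈-++⁺ˡ (parts-complete n 1 (n ∸ 1) (pred-< 1≤n (n<1+n n)) ≤-refl (record
    { nonincreasing = IsPartition.nonincreasing p
    ; bounded       = IsPartition.positive p
    ; sums          = trans (IsPartition.sums p) n≡1+[n-1]
    ; twoParts      = s≤s (s≤s z≤n) }))

  ∈-partition : ∀ {ps} → ps ∈ partitions → IsPartition n ps
  ∈-partition {ps} ps∈ with ∈-++⁻ (parts n 1 (n ∸ 1)) ps∈
  ... | inj₁ ps∈parts = record
          { nonincreasing = IsPartAbove.nonincreasing pa
          ; positive      = IsPartAbove.bounded pa
          ; sums          = trans (IsPartAbove.sums pa) (sym n≡1+[n-1]) }
    where pa : IsPartAbove 1 (1 + (n ∸ 1)) ps
          pa = parts-sound n 1 (n ∸ 1) ≤-refl ps∈parts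
  ... | inj₂ (here refl) = record { nonincreasing = [-] ; positive = 1≤n ∷ [] ; sums = +-identityʳ n }

  partitions-unique : Unique partitions
  partitions-unique = Unique.++⁺ (parts-unique n 1 (n ∸ 1) ≤-refl) ([] ∷ []) two-parts-≢-[n]
    where
      two-parts-≢-[n] : ∀ {ps} → ¬ (ps ∈ parts n 1 (n ∸ 1) × ps ∈ (n ∷ []) ∷ [])
      two-parts-≢-[n] (ps∈ , here refl) with IsPartAbove.twoParts (parts-sound n 1 (n ∸ 1) ≤-refl ps∈)
      ... | s≤s ()

  count-partitions : ∀ P → Unique P → (∀ ps → ps ∈ P ⇔ IsPartition n ps) → length P ≡ B n 1 (n ∸ 1) + 1
  count-partitions P P! P≡ = begin
    length P                                      ≡⟨ unique-length P! partitions-unique same ⟩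
    length partitions                             ≡⟨ length-++ (parts n 1 (n ∸ 1)) ⟩
    length (parts n 1 (n ∸ 1)) + 1                ≡⟨ cong (_+ 1) (length-parts n 1 (n ∸ 1)) ⟩
    B n 1 (n ∸ 1) + 1                             ∎
    where
      open ≡-Reasoning
      same : ∀ ps → ps ∈ P ⇔ ps ∈ partitions
      same ps = ⇔.trans (P≡ ps) (mk⇔ (partition-∈ ps) ∈-partition)

  -- p⁽²⁾(n) = C(1, n − 1) + 1, the one-part partition [n] satisfying the condition
  count-partitions₂ : ∀ P → Unique P → (∀ ps → ps ∈ P ⇔ (IsPartition n ps × Cond2 ps))
                    → length P ≡ C n 1 (n ∸ 1) + 1
  count-partitions₂ P P! P≡ = begin
    length P                                      ≡⟨ unique-length P! (Unique.filter⁺ Cond2? partitions-unique) same ⟩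
    length (filter Cond2? partitions)             ≡⟨ cong length (filter-++ Cond2? (parts n 1 (n ∸ 1)) ((n ∷ []) ∷ [])) ⟩
    length (filter Cond2? (parts n 1 (n ∸ 1)) ++ (n ∷ []) ∷ [])
                                                  ≡⟨ length-++ (filter Cond2? (parts n 1 (n ∸ 1))) ⟩
    length (filter Cond2? (parts n 1 (n ∸ 1))) + 1 ≡⟨ cong (_+ 1) (count-parts n 1 (n ∸ 1) ≤-refl) ⟩
    C n 1 (n ∸ 1) + 1                             ∎
    where
      open ≡-Reasoning
      same : ∀ ps → ps ∈ P ⇔ ps ∈ filter Cond2? partitions
      same ps = ⇔.trans (P≡ ps) (mk⇔ (λ (p , c) → ∈-filter⁺ Cond2? (partition-∈ ps p) c)
                                     (λ ps∈ → let (ps∈′ , c) = ∈-filter⁻ Cond2? ps∈ in ∈-partition ps∈′ , c))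

-- The totals: 3 + (4B + 4C + 5) assignments and 1 + (B + 3C + 2) + 1 tests.
total-asg : ∀ b c → 3 + (4 * b + 4 * c + 5) ≡ 4 * (b + 1) + 4 * (c + 1)
total-asg = solve-∀

total-bev : ∀ b c → suc (1 + (b + 3 * c + 2)) ≡ (b + 1) + 3 * (c + 1)
total-bev = solve-∀

theorem5 : (n : ℕ) → 1 ≤ n → (a : ℕ → ℤ)
    → (P P2 : List (List ℕ))
    → Unique P → (∀ ps → ps ∈ P ⇔ IsPartition n ps)
    → Unique P2 → (∀ ps → ps ∈ P2 ⇔ (IsPartition n ps × Cond2 ps))
    → ∃[ fuel ] run n fuel start (initConfig a)
        ≡ just (4 * length P + 4 * length P2 , length P + 3 * length P2)
theorem5 n 1≤n a P P2 P! P≡ P2! P2≡ with Simulation.algorithm-run n 1≤n a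
... | fuel , run≡ = fuel , (begin
  run n fuel start (initConfig a)                               ≡⟨ run≡ ⟩
  just (3 + (4 * b + 4 * c + 5) , suc (1 + (b + 3 * c + 2)))    ≡⟨ cong₂ (λ u v → just (u , v)) (total-asg b c) (total-bev b c) ⟩
  just (4 * (b + 1) + 4 * (c + 1) , (b + 1) + 3 * (c + 1))      ≡⟨ cong₂ (λ p p₂ → just (4 * p + 4 * p₂ , p + 3 * p₂)) (sym p≡) (sym p₂≡) ⟩
  just (4 * length P + 4 * length P2 , length P + 3 * length P2) ∎)
  where
    open ≡-Reasoning
    open PartitionsOf n 1≤n
    b c : ℕ
    b = B n 1 (n ∸ 1)
    c = C n 1 (n ∸ 1)
    p≡ : length P ≡ b + 1
    p≡ = count-partitions P P! P≡
    p₂≡ : length P2 ≡ c + 1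
    p₂≡ = count-partitions₂ P2 P2! P2≡
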